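{- Let $m\ge1$ and let $T_1,\dots,T_m$ be nonempty ordered trees. The following are equivalent: (1) the ordered forest $T_1T_2\cdots T_m$ belongs to $\mathcal G$; (2) $T_1\in\mathcal G$ and $T_2,\dots,T_m\in\mathcal G^0$. In particular, for every forest $T_1\cdots T_m\in\mathcal G$, the trees $T_1,\dots,T_m$ all belong to $\mathcal G$.
   Context: An ordered forest of degree $n\ge 0$ is a planar rooted forest with $n$ vertices (a left-to-right sequence of rooted trees, the children of each vertex linearly ordered from left to right) together with a bijection from its vertex set to $\{1,\dots,n\}$ (labels); edges point towards roots. $1$ is the empty forest, $\bullet_1$ the one-vertex tree, an ordered tree is a forest with one component, $|F|$ is the degree. The product $FG$ of ordered forests is their concatenation (trees of $F$, then trees of $G$), where labels of $F$ are kept and labels of $G$ are increased by $|F|$; $T_1\cdots T_m$ denotes such an iterated product. For $n\ge1$ and $\underline\varepsilon=(\varepsilon_1,\dots,\varepsilon_n)\in\{+,-\}^n$ define sets $\mathcal G^{(\underline\varepsilon)}$ of ordered forests of degree $n$ recursively: $\mathcal G^{(\varepsilon_1)}=\{\bullet_1\}$; for $n\ge2$, let $F'$ range over $\mathcal G^{(\varepsilon_1,\dots,\varepsilon_{n-1})}$ with trees $T_1,\dots,T_m$ from left to right; all vertices of $F'$ keep their labels and a new vertex labelled $n$ is added. If $\varepsilon_n=-$: add a new root whose children are the roots of $T_1,\dots,T_m$ in order. If $\varepsilon_n=+$: either add the new vertex as a one-vertex tree at the right end, or, for some $1\le i\le m$, attach the new vertex as rightmost child of the root of $T_i$ and make the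 roots of $T_{i+1},\dots,T_m$ (in order) the children of the new vertex. $\mathcal G^{(\underline\varepsilon)}$ is the set of all forests so obtained. Put $\mathcal G=\bigcup_{n\ge1}\bigcup_{\underline\varepsilon\in\{+,-\}^n}\mathcal G^{(\underline\varepsilon)}$ and $\mathcal G^0=\bigcup_{n\ge1}\mathcal G^{(+,+,\dots,+)}$ (words consisting only of $+$, of length $n$). -}

module Defs where

open import Data.Nat using (ℕ; zero; suc; _+_)
open import Data.List using (List; []; _∷_; _++_; [_]; length; map; upTo; replicate)
open import Data.List.Relation.Binary.Permutation.Propositional using (_↭_)
open import Data.Product using (Σ; _×_)

data Tree : Set where
  node : ℕ → List Tree → Tree

Forest : Set
Forest = List Tree

mutual
  labelsT : Tree → List ℕ
  labelsT (node l cs) = l ∷ labelsF cs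

  labelsF : Forest → List ℕ
  labelsF [] = []
  labelsF (t ∷ ts) = labelsT t ++ labelsF ts

deg : Forest → ℕ
deg F = length (labelsF F)

-- An ordered forest: the labelling is a bijection onto {1,…,deg F},
-- i.e. the list of labels is a permutation of [1,…,deg F].
IsOrdered : Forest → Set
IsOrdered F = labelsF F ↭ map suc (upTo (deg F))

IsOrderedTree : Tree → Set
IsOrderedTree T = IsOrdered [ T ]

mutual
  shiftT : ℕ → Tree → Tree
  shiftT k (node l cs) = node (k + l) (shiftF k cs)

  shiftF : ℕ → Forest → Forest
  shiftF k [] = []
  shiftF k (t ∷ ts) = shiftT k t ∷ shiftF k ts

_·_ : Forest → Forest → Forest
F · G = F ++ shiftF (deg F) G

prodTrees : List Tree → Forest
prodTrees [] = []
prodTrees (T ∷ Ts) = [ T ] · prodTrees Ts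

data Sign : Set where
  plus minus : Sign

-- One step of the recursive construction: adding the vertex labelled n
-- with sign s turns F' into F.
data Step (n : ℕ) : Sign → Forest → Forest → Set where
  minusRoot : ∀ F → Step n minus F [ node n F ]
  plusLeaf  : ∀ F → Step n plus F (F ++ [ node n [] ])
  plusAttach : ∀ A l cs B →
    Step n plus (A ++ node l cs ∷ B) (A ++ [ node l (cs ++ [ node n B ]) ])

data Gen : List Sign → Forest → Set where
  base : ∀ s → Gen [ s ] [ node 1 [] ]
  step : ∀ {εs F F'} s → Gen εs F → Step (suc (length εs)) s F F' →
         Gen (εs ++ [ s ]) F'

InG : Forest → Set
InG F = Σ (List Sign) (λ εs → Gen εs F)

InG0 : Forest → Set
InG0 F = Σ ℕ (λ n → Gen (replicate (suc n) plus) F)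

-- If F · G ∈ 𝒢 with F and G nonempty, the last construction step is not a (−)-step,
-- which would leave a single tree; so it is a (+)-step, and its new vertex, lying in the
-- last tree, lies in the G-part. Undoing it undoes a (+)-step of G shifted by |F|, so
-- induction on the construction splits it into a construction of F followed by an
-- all-(+) construction of G. Conversely, replaying an all-(+) construction of G after
-- one of F, with labels shifted by |F|, constructs F · G.
module Submission where

open import Defs
open import Data.List using (List; []; _∷_; [_])
open import Data.List.Relation.Unary.All using (All)
open import Data.Product using (_×_)
open import Function.Bundles using (_⇔_)

open import Data.Nat using (ℕ; suc; _+_)
open import Data.Nat.Properties using (+-suc; +-comm; +-identityʳ; +-cancelˡ-≡)
open import Data.List using (_++_; _∷ʳ_; length; map; replicate)
open import Data.List.Properties
  using (++-assoc; ++-identityʳ; ++-conicalʳ; length-++; length-map; map-++; ∷-injectiveʳ; ∷ʳ-injective; ∷ʳ-injectiveʳ)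
open import Data.List.Reverse using (Reverse; []; _∶_∶ʳ_; reverseView)
open import Data.List.Relation.Unary.All using ([]; _∷_)
import Data.List.Relation.Unary.All as All
open import Data.List.Relation.Unary.All.Properties using (++⁺; ++⁻ˡ; ++⁻ʳ; replicate⁺)
open import Data.Product using (Σ; ∃; _,_; proj₁; proj₂)
open import Data.Empty using (⊥-elim)
open import Function.Bundles using (mk⇔)
open import Relation.Binary.Construct.Closure.ReflexiveTransitive using (Star; ε; _◅_; _◅◅_; gmap)
open import Relation.Binary.PropositionalEquality
  using (_≡_; _≢_; refl; sym; trans; cong; cong₂; subst; subst₂; module ≡-Reasoning)

length-∷ʳ : ∀ {A : Set} (xs : List A) x → length (xs ∷ʳ x) ≡ suc (length xs)
length-∷ʳ xs x = trans (length-++ xs) (+-comm (length xs) 1)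

∷ʳ≢[] : ∀ {A : Set} (xs : List A) {x} → xs ∷ʳ x ≢ []
∷ʳ≢[] xs eq with () ← ++-conicalʳ xs _ eq

root : Tree → ℕ
root (node l _) = l

children : Tree → Forest
children (node _ cs) = cs

labelsF-++ : ∀ F G → labelsF (F ++ G) ≡ labelsF F ++ labelsF G
labelsF-++ []      G = refl
labelsF-++ (t ∷ F) G = trans (cong (labelsT t ++_) (labelsF-++ F G)) (sym (++-assoc (labelsT t) _ _))

mutual
  labelsT-shiftT : ∀ k t → labelsT (shiftT k t) ≡ map (k +_) (labelsT t)
  labelsT-shiftT k (node l cs) = cong (k + l ∷_) (labelsF-shiftF k cs)

  labelsF-shiftF : ∀ k F → labelsF (shiftF k F) ≡ map (k +_) (labelsF F)
  labelsF-shiftF k []      = refl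
  labelsF-shiftF k (t ∷ F) =
    trans (cong₂ _++_ (labelsT-shiftT k t) (labelsF-shiftF k F))
          (sym (map-++ (k +_) (labelsT t) (labelsF F)))

deg-++ : ∀ F G → deg (F ++ G) ≡ deg F + deg G
deg-++ F G = trans (cong length (labelsF-++ F G)) (length-++ (labelsF F))

deg-shiftF : ∀ k F → deg (shiftF k F) ≡ deg F
deg-shiftF k F = trans (cong length (labelsF-shiftF k F)) (length-map (k +_) (labelsF F))

deg-· : ∀ F G → deg (F · G) ≡ deg F + deg G
deg-· F G = trans (deg-++ F _) (cong (deg F +_) (deg-shiftF (deg F) G))

deg-∷ : ∀ l cs F → deg (node l cs ∷ F) ≡ suc (deg cs + deg F)
deg-∷ l cs F = cong suc (length-++ (labelsF cs))

deg-[node] : ∀ l cs → deg [ node l cs ] ≡ suc (deg cs)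
deg-[node] l cs = trans (deg-∷ l cs []) (cong suc (+-identityʳ (deg cs)))

deg-Step : ∀ {n s F F'} → Step n s F F' → deg F' ≡ suc (deg F)
deg-Step {n} (minusRoot F) = deg-[node] n F
deg-Step {n} (plusLeaf F)  = trans (deg-++ F _) (+-comm (deg F) 1)
deg-Step {n} (plusAttach A l cs B) = begin
  deg (A ∷ʳ node l (cs ∷ʳ node n B))       ≡⟨ deg-++ A _ ⟩
  deg A + deg [ node l (cs ∷ʳ node n B) ]  ≡⟨ cong (deg A +_) (deg-[node] l (cs ∷ʳ node n B)) ⟩
  deg A + suc (deg (cs ∷ʳ node n B))       ≡⟨ cong (λ d → deg A + suc d) (deg-++ cs _) ⟩
  deg A + suc (deg cs + deg [ node n B ])  ≡⟨ cong (λ d → deg A + suc (deg cs + d)) (deg-[node] n B) ⟩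
  deg A + suc (deg cs + suc (deg B))       ≡⟨ +-suc (deg A) _ ⟩
  suc (deg A + (deg cs + suc (deg B)))     ≡⟨ cong (λ d → suc (deg A + d)) (+-suc (deg cs) (deg B)) ⟩
  suc (deg A + suc (deg cs + deg B))       ≡⟨ cong (λ d → suc (deg A + d)) (sym (deg-∷ l cs B)) ⟩
  suc (deg A + deg (node l cs ∷ B))        ≡⟨ cong suc (sym (deg-++ A _)) ⟩
  suc (deg (A ++ node l cs ∷ B))           ∎
  where open ≡-Reasoning

deg-Gen : ∀ {εs F} → Gen εs F → deg F ≡ length εs
deg-Gen (base s)                = refl
deg-Gen (step {εs} s g st) =
  trans (deg-Step st) (trans (cong suc (deg-Gen g)) (sym (length-∷ʳ εs s)))

shiftF-++ : ∀ k F G → shiftF k (F ++ G) ≡ shiftF k F ++ shiftF k G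
shiftF-++ k []      G = refl
shiftF-++ k (t ∷ F) G = cong (shiftT k t ∷_) (shiftF-++ k F G)

·-++ : ∀ F G H → F · (G ++ H) ≡ (F · G) ++ shiftF (deg F) H
·-++ F G H = trans (cong (F ++_) (shiftF-++ (deg F) G H)) (sym (++-assoc F _ _))

Step-· : ∀ {n G H} F → Step n plus G H → Step (deg F + n) plus (F · G) (F · H)
Step-· {n} F (plusLeaf G) =
  subst (Step (deg F + n) plus (F · G)) (sym (·-++ F G _)) (plusLeaf (F · G))
Step-· {n} F (plusAttach A l cs B) =
  subst₂ (Step (deg F + n) plus) (sym (·-++ F A _)) after
    (plusAttach (F · A) (k + l) (shiftF k cs) (shiftF k B))
  where
  k = deg F
  after : (F · A) ∷ʳ node (k + l) (shiftF k cs ∷ʳ node (k + n) (shiftF k B))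
        ≡ F · (A ∷ʳ node l (cs ∷ʳ node n B))
  after = trans (cong (λ cs′ → (F · A) ∷ʳ node (k + l) cs′) (sym (shiftF-++ k cs _)))
                (sym (·-++ F A _))

Step-·⁻¹ : ∀ {n X Z} F G y → Step n plus X Z → Z ≡ F · (G ∷ʳ y) →
           Σ Forest λ H → Σ ℕ λ m → X ≡ F · H × deg F + m ≡ n × Step m plus H (G ∷ʳ y)
Step-·⁻¹ F G (node l []) (plusLeaf X) eq
  with refl , e ← ∷ʳ-injective X (F · G) (trans eq (·-++ F G _))
  = G , l , refl , cong root (sym e) , plusLeaf G
Step-·⁻¹ F G (node l (_ ∷ _)) (plusLeaf X) eq
  with () ← ∷ʳ-injectiveʳ X (F · G) (trans eq (·-++ F G _))
Step-·⁻¹ F G (node l′ cs″) (plusAttach A l cs B) eq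
  with refl , e ← ∷ʳ-injective A (F · G) (trans eq (·-++ F G _)) | reverseView cs″
... | [] = ⊥-elim (∷ʳ≢[] cs (cong children e))
... | cs′ ∶ _ ∶ʳ node m B′
  with refl , e′ ← ∷ʳ-injective cs _ (trans (cong children e) (shiftF-++ (deg F) cs′ _))
  with refl ← cong root e | refl ← cong children e′
  = G ++ node l′ cs′ ∷ B′ , m , sym (·-++ F G _) , cong root (sym e′) , plusAttach G l′ cs′ B′

data _⟶⁺_ : List Sign × Forest → List Sign × Forest → Set where
  plusStep : ∀ {εs F F′} → Step (suc (length εs)) plus F F′ → (εs , F) ⟶⁺ (εs ∷ʳ plus , F′)

_⟶⁺*_ : List Sign × Forest → List Sign × Forest → Set
_⟶⁺*_ = Star _⟶⁺_

-- Unlike 𝒢⁰, this family contains the empty forest, the unit of the product.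
PlusGen : List Sign → Forest → Set
PlusGen ρs G = ([] , []) ⟶⁺* (ρs , G)

Gen-⟶⁺* : ∀ {εs σs F X} → Gen εs F → (εs , F) ⟶⁺* (σs , X) → Gen σs X
Gen-⟶⁺* g ε                 = g
Gen-⟶⁺* g (plusStep st ◅ r) = Gen-⟶⁺* (step plus g st) r

deg-⟶⁺* : ∀ {εs σs F X} → deg F ≡ length εs → (εs , F) ⟶⁺* (σs , X) → deg X ≡ length σs
deg-⟶⁺* d ε                      = d
deg-⟶⁺* d (plusStep {εs} st ◅ r) =
  deg-⟶⁺* (trans (deg-Step st) (trans (cong suc d) (sym (length-∷ʳ εs plus)))) r

All-⟶⁺* : ∀ {εs σs F X} → All (_≡ plus) εs → (εs , F) ⟶⁺* (σs , X) → All (_≡ plus) σs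
All-⟶⁺* a ε                       = a
All-⟶⁺* a (plusStep {εs} st ◅ r) = All-⟶⁺* (++⁺ a (refl ∷ [])) r

·-⟶⁺* : ∀ {εs ρs σs F G H} → deg F ≡ length εs →
        (ρs , G) ⟶⁺* (σs , H) → (εs ++ ρs , F · G) ⟶⁺* (εs ++ σs , F · H)
·-⟶⁺* {εs} {F = F} d = gmap (λ (ρs , G) → εs ++ ρs , F · G) shifted
  where
  shifted : ∀ {i j} → i ⟶⁺ j → (εs ++ proj₁ i , F · proj₂ i) ⟶⁺ (εs ++ proj₁ j , F · proj₂ j)
  shifted (plusStep {ρs} {G} {G′} st) =
    subst (λ σ → (εs ++ ρs , F · G) ⟶⁺ (σ , F · G′)) (++-assoc εs ρs [ plus ])
      (plusStep (subst (λ n → Step n plus (F · G) (F · G′)) label (Step-· F st)))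
    where
    label : deg F + suc (length ρs) ≡ suc (length (εs ++ ρs))
    label = trans (+-suc (deg F) _)
                  (cong suc (trans (cong (_+ length ρs) d) (sym (length-++ εs))))

PlusGen-after : ∀ {εs ρs F G} → deg F ≡ length εs → PlusGen ρs G → (εs , F) ⟶⁺* (εs ++ ρs , F · G)
PlusGen-after {εs} {ρs} {F} {G} d p =
  subst (_⟶⁺* (εs ++ ρs , F · G)) (cong₂ _,_ (++-identityʳ εs) (++-identityʳ F)) (·-⟶⁺* d p)

Gen-· : ∀ {εs ρs F G} → Gen εs F → PlusGen ρs G → Gen (εs ++ ρs) (F · G)
Gen-· g p = Gen-⟶⁺* g (PlusGen-after (deg-Gen g) p)

PlusGen-· : ∀ {ρs σs F G} → PlusGen ρs F → PlusGen σs G → PlusGen (ρs ++ σs) (F · G)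
PlusGen-· p q = p ◅◅ PlusGen-after (deg-⟶⁺* refl p) q

Gen⇒PlusGen : ∀ {εs F} → Gen εs F → All (_≡ plus) εs → PlusGen εs F
Gen⇒PlusGen (base s)           (refl ∷ []) = plusStep (plusLeaf []) ◅ ε
Gen⇒PlusGen (step {εs} s g st) a with ++⁻ʳ εs a
... | refl ∷ [] = Gen⇒PlusGen g (++⁻ˡ εs a) ◅◅ plusStep st ◅ ε

Step-from-[] : ∀ {n F X} → Step n plus F X → F ≡ [] → X ≡ [ node n [] ]
Step-from-[] (plusLeaf F)          refl = refl
Step-from-[] (plusAttach A l cs B) eq   with () ← ++-conicalʳ A _ eq

PlusGen⇒Gen : ∀ {ρs t F} → PlusGen ρs (t ∷ F) → Gen ρs (t ∷ F)
PlusGen⇒Gen (plusStep st ◅ p) = Gen-⟶⁺* (subst (Gen [ plus ]) (sym (Step-from-[] st refl)) (base plus)) p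

record Splitting (εs : List Sign) (F G : Forest) : Set where
  constructor splitting
  field
    {signsF signsG} : List Sign
    signs-++ : εs ≡ signsF ++ signsG
    genF     : Gen signsF F
    plusGenG : PlusGen signsG G

[_]≢·∷ʳ : ∀ t {f F G y} → [ t ] ≢ (f ∷ F) · (G ∷ʳ y)
[ t ]≢·∷ʳ {f} {F} {G} {y} eq =
  ∷ʳ≢[] (shiftF k G) (trans (sym (shiftF-++ k G [ y ])) (++-conicalʳ F _ (sym (∷-injectiveʳ eq))))
  where k = deg (f ∷ F)

fresh-label : ∀ F H {n m} → deg (F · H) ≡ n → deg F + m ≡ suc n → m ≡ suc (deg H)
fresh-label F H {n} {m} d label = +-cancelˡ-≡ (deg F) m (suc (deg H)) (begin
  deg F + m           ≡⟨ label ⟩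
  suc n               ≡⟨ cong suc (trans (sym d) (deg-· F H)) ⟩
  suc (deg F + deg H) ≡⟨ +-suc (deg F) (deg H) ⟨
  deg F + suc (deg H) ∎)
  where open ≡-Reasoning

split-view : ∀ {εs X f F G} → Gen εs X → Reverse G → X ≡ (f ∷ F) · G → Splitting εs (f ∷ F) G
split-view {εs} g [] eq = splitting (sym (++-identityʳ εs)) (subst (Gen εs) (trans eq (++-identityʳ _)) g) ε
split-view {f = f} {F} (base s) (G ∶ _ ∶ʳ y) eq =
  ⊥-elim ([ node 1 [] ]≢·∷ʳ {f} {F} {G} {y} eq)
split-view {f = f} {F} (step minus g (minusRoot F′)) (G ∶ _ ∶ʳ y) eq =
  ⊥-elim ([ node _ F′ ]≢·∷ʳ {f} {F} {G} {y} eq)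
split-view {f = f} {F} (step plus g st) (G ∶ _ ∶ʳ y) eq
  with H , m , refl , label , st′ ← Step-·⁻¹ (f ∷ F) G y st eq
  with splitting {σs} {ρs} signs gF pH ← split-view {f = f} {F} g (reverseView H) refl
  = splitting (trans (cong (_∷ʳ plus) signs) (++-assoc σs ρs [ plus ])) gF
              (pH ◅◅ plusStep (subst (λ n → Step n plus H (G ∷ʳ y)) m≡ st′) ◅ ε)
  where
  m≡ : m ≡ suc (length ρs)
  m≡ = trans (fresh-label (f ∷ F) H (deg-Gen g) label) (cong suc (deg-⟶⁺* refl pH))

split : ∀ {εs f F G} → Gen εs ((f ∷ F) · G) → Splitting εs (f ∷ F) G
split g = split-view g (reverseView _) refl

PlusGen-split : ∀ {ρs f F G} → PlusGen ρs ((f ∷ F) · G) →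
                (∃ λ σs → PlusGen σs (f ∷ F)) × (∃ λ τs → PlusGen τs G)
PlusGen-split p with splitting {σs} signs gF pG ← split (PlusGen⇒Gen p) =
  (σs , Gen⇒PlusGen gF (++⁻ˡ σs (subst (All (_≡ plus)) signs (All-⟶⁺* [] p)))) , (_ , pG)

All-≡⇒replicate : ∀ {A : Set} {x : A} {xs} → All (_≡ x) xs → xs ≡ replicate (length xs) x
All-≡⇒replicate []         = refl
All-≡⇒replicate (refl ∷ a) = cong (_ ∷_) (All-≡⇒replicate a)

PlusGen⇒InG0 : ∀ {ρs t F} → PlusGen ρs (t ∷ F) → InG0 (t ∷ F)
PlusGen⇒InG0 {[]} {node l cs} p with () ← deg-⟶⁺* refl p
PlusGen⇒InG0 {s ∷ ρs} {t} {F} p =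
  length ρs , subst (λ σs → Gen σs (t ∷ F)) (All-≡⇒replicate (All-⟶⁺* [] p)) (PlusGen⇒Gen p)

InG0⇒PlusGen : ∀ {F} → InG0 F → ∃ λ ρs → PlusGen ρs F
InG0⇒PlusGen (n , g) = _ , Gen⇒PlusGen g (replicate⁺ (suc n) refl)

PlusGen-prodTrees⁻ : ∀ {ρs} Us → PlusGen ρs (prodTrees Us) → All (λ U → InG0 [ U ]) Us
PlusGen-prodTrees⁻ []       _ = []
PlusGen-prodTrees⁻ (U ∷ Us) p with (_ , pU) , (_ , pUs) ← PlusGen-split {f = U} {F = []} p =
  PlusGen⇒InG0 pU ∷ PlusGen-prodTrees⁻ Us pUs

PlusGen-prodTrees⁺ : ∀ {Us} → All (λ U → InG0 [ U ]) Us → ∃ λ ρs → PlusGen ρs (prodTrees Us)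
PlusGen-prodTrees⁺ []       = [] , ε
PlusGen-prodTrees⁺ (u ∷ us) with _ , p ← InG0⇒PlusGen u | _ , q ← PlusGen-prodTrees⁺ us =
  _ , PlusGen-· p q

prodTrees∈G⇒ : ∀ T Ts → InG (prodTrees (T ∷ Ts)) → InG [ T ] × All (λ U → InG0 [ U ]) Ts
prodTrees∈G⇒ T Ts (_ , g) with splitting _ gT pTs ← split {f = T} {F = []} g =
  (_ , gT) , PlusGen-prodTrees⁻ Ts pTs

prodTrees∈G⇐ : ∀ T Ts → InG [ T ] × All (λ U → InG0 [ U ]) Ts → InG (prodTrees (T ∷ Ts))
prodTrees∈G⇐ T Ts ((_ , g) , us) with _ , p ← PlusGen-prodTrees⁺ us = _ , Gen-· g p

InG0⇒InG : ∀ {F} → InG0 F → InG F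
InG0⇒InG (_ , g) = _ , g

mainTheorem2 : (T : Tree) (Ts : List Tree) →
    IsOrderedTree T → All IsOrderedTree Ts →
    (InG (prodTrees (T ∷ Ts)) ⇔ (InG [ T ] × All (λ U → InG0 [ U ]) Ts))
    × (InG (prodTrees (T ∷ Ts)) → All (λ U → InG [ U ]) (T ∷ Ts))
mainTheorem2 T Ts _ _ = mk⇔ (prodTrees∈G⇒ T Ts) (prodTrees∈G⇐ T Ts) , all-trees∈G
  where
  all-trees∈G : InG (prodTrees (T ∷ Ts)) → All (λ U → InG [ U ]) (T ∷ Ts)
  all-trees∈G h with t , us ← prodTrees∈G⇒ T Ts h = t ∷ All.map InG0⇒InG us
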